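{- Let $\mathcal{T}$ be a transition system and let $\mathbf{G}\varphi_1,\ldots,\mathbf{G}\varphi_n$ be LTL formulas in which each $\varphi_i$ is a syntactically safe LTL formula. If $\mathit{val}_{\mathcal{T}}(\mathbf{G}\varphi_1\wedge\ldots\wedge\mathbf{G}\varphi_n)=v$, then there exists an LTL formula $\psi_v$ such that $\mathcal{T}\models\psi_v$ and (1) $\psi_v=\varphi_1'\wedge\ldots\wedge\varphi_n'$, where $\varphi_i'\in\{\mathbf{G}\varphi_i,\ \mathbf{F}\mathbf{G}\varphi_i,\ \mathbf{G}\mathbf{F}\varphi_i,\ \mathit{true}\}$ for $i=1,\ldots,n$; (2) for every transition system $\mathcal{T}'$, if $\mathcal{T}'\models\psi_v$ then $\mathit{val}_{\mathcal{T}'}(\mathbf{G}\varphi_1\wedge\ldots\wedge\mathbf{G}\varphi_n)\geq v$ (in the lexicographic order on $\{0,\ldots,n\}^3$).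
   Context: LTL over a finite set $AP$ of atomic propositions (operators $\mathbf{X},\mathbf{U},\mathbf{R}$, with $\mathbf{F}\varphi=\mathit{true}\,\mathbf{U}\,\varphi$, $\mathbf{G}\varphi=\mathit{false}\,\mathbf{R}\,\varphi$), interpreted over infinite words over $\Sigma=2^{AP}$. An LTL formula is syntactically safe if its negation normal form contains no $\mathbf{U}$. $AP$ is partitioned into inputs $I$ and outputs $O$. A transition system is $\mathcal{T}=(S,s_0,\tau)$ with set of states $S$ (possibly infinite), initial state $s_0$, and $\tau:S\times 2^I\to S\times 2^O$. Its traces are the words $(\iota_0\cup o_0)(\iota_1\cup o_1)\ldots$ such that there are states $s_0,s_1,\ldots$ with $(s_{i+1},o_i)=\tau(s_i,\iota_i)$ for all $i$. $\mathcal{T}\models\psi$ means every trace of $\mathcal{T}$ satisfies $\psi$. For syntactically safe $\varphi$, $\mathit{val}_{\mathcal{T}}(\mathbf{G}\varphi)=(v_1,v_2,v_3)\in\{0,1\}^3$ where $v_1=1$ iff $\mathcal{T}\models\mathbf{G}\varphi$, $v_2=1$ iff $\mathcal{T}\models\mathbf{F}\mathbf{G}\varphi$, $v_3=1$ iff $\mathcal{T}\models\mathbf{G}\mathbf{F}\varphi$. For a conjunction, with $\mathit{val}_{\mathcal{T}}(\mathbf{G}\varphi_i)=(v_{i,1},v_{i,2},v_{i,3})$, define $\mathit{val}_{\mathcal{T}}(\mathbf{G}\varphi_1\wedge\ldots\wedge\mathbf{G}\varphi_n)=\big(\sum_{i=1}^n v_{i,3},\sum_{i=1}^n v_{i,2},\sum_{i=1}^n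 v_{i,1}\big)\in\{0,\ldots,n\}^3$, compared lexicographically. -}

module Defs where

open import Data.Nat using (ℕ; zero; suc; _+_; _<_; _≤_; _>_)
open import Data.Bool using (Bool; true; false)
open import Data.Fin using (Fin; zero; suc)
open import Data.Sum using (_⊎_; inj₁; inj₂)
open import Data.Product using (Σ; ∃; _×_; _,_)
open import Data.Unit using (⊤)
open import Data.Empty using (⊥)
open import Relation.Nullary using (¬_)
open import Relation.Nullary.Reflects using (Reflects)
open import Relation.Binary.PropositionalEquality using (_≡_)

-- Atomic propositions: AP = I ⊎ O, with I = Fin ni inputs, O = Fin no outputs.

module _ (ni no : ℕ) where
  AP : Set
  AP = Fin ni ⊎ Fin no

data LTL (A : Set) : Set where
  tt ff : LTL A
  ap    : A → LTL A
  ¬ₗ_   : LTL A → LTL A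
  _∧ₗ_ _∨ₗ_ : LTL A → LTL A → LTL A
  Xₗ    : LTL A → LTL A
  _Uₗ_ _Rₗ_ : LTL A → LTL A → LTL A

module _ {A : Set} where

  Fₗ Gₗ : LTL A → LTL A
  Fₗ φ = tt Uₗ φ
  Gₗ φ = ff Rₗ φ

  -- negation normal form; nnf⁺ φ is the NNF of φ, nnf⁻ φ the NNF of ¬ φ
  nnf⁺ nnf⁻ : LTL A → LTL A
  nnf⁺ tt = tt
  nnf⁺ ff = ff
  nnf⁺ (ap p) = ap p
  nnf⁺ (¬ₗ φ) = nnf⁻ φ
  nnf⁺ (φ ∧ₗ ψ) = nnf⁺ φ ∧ₗ nnf⁺ ψ
  nnf⁺ (φ ∨ₗ ψ) = nnf⁺ φ ∨ₗ nnf⁺ ψ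
  nnf⁺ (Xₗ φ) = Xₗ (nnf⁺ φ)
  nnf⁺ (φ Uₗ ψ) = nnf⁺ φ Uₗ nnf⁺ ψ
  nnf⁺ (φ Rₗ ψ) = nnf⁺ φ Rₗ nnf⁺ ψ
  nnf⁻ tt = ff
  nnf⁻ ff = tt
  nnf⁻ (ap p) = ¬ₗ (ap p)
  nnf⁻ (¬ₗ φ) = nnf⁺ φ
  nnf⁻ (φ ∧ₗ ψ) = nnf⁻ φ ∨ₗ nnf⁻ ψ
  nnf⁻ (φ ∨ₗ ψ) = nnf⁻ φ ∧ₗ nnf⁻ ψ
  nnf⁻ (Xₗ φ) = Xₗ (nnf⁻ φ)
  nnf⁻ (φ Uₗ ψ) = nnf⁻ φ Rₗ nnf⁻ ψ
  nnf⁻ (φ Rₗ ψ) = nnf⁻ φ Uₗ nnf⁻ ψ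

  NoU : LTL A → Set
  NoU tt = ⊤
  NoU ff = ⊤
  NoU (ap p) = ⊤
  NoU (¬ₗ φ) = NoU φ
  NoU (φ ∧ₗ ψ) = NoU φ × NoU ψ
  NoU (φ ∨ₗ ψ) = NoU φ × NoU ψ
  NoU (Xₗ φ) = NoU φ
  NoU (φ Uₗ ψ) = ⊥
  NoU (φ Rₗ ψ) = NoU φ × NoU ψ

  SyntacticallySafe : LTL A → Set
  SyntacticallySafe φ = NoU (nnf⁺ φ)

  -- Semantics over infinite words w : ℕ → 2^A (letters are A → Bool);
  -- Sat w i φ means the suffix w^i satisfies φ.

  Word : Set
  Word = ℕ → (A → Bool)

  Sat : Word → ℕ → LTL A → Set
  Sat w i tt = ⊤
  Sat w i ff = ⊥
  Sat w i (ap p) = w i p ≡ true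
  Sat w i (¬ₗ φ) = ¬ Sat w i φ
  Sat w i (φ ∧ₗ ψ) = Sat w i φ × Sat w i ψ
  Sat w i (φ ∨ₗ ψ) = Sat w i φ ⊎ Sat w i ψ
  Sat w i (Xₗ φ) = Sat w (suc i) φ
  Sat w i (φ Uₗ ψ) = Σ ℕ λ j → Sat w (j + i) ψ × (∀ k → k < j → Sat w (k + i) φ)
  Sat w i (φ Rₗ ψ) = ∀ j → Sat w (j + i) ψ ⊎ Σ ℕ (λ k → k < j × Sat w (k + i) φ)

  ⋀ : (n : ℕ) → (Fin n → LTL A) → LTL A
  ⋀ zero φ = tt
  ⋀ (suc n) φ = φ zero ∧ₗ ⋀ n (λ i → φ (suc i))

record TS (ni no : ℕ) : Set₁ where
  field
    S  : Set
    s₀ : S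
    τ  : S → (Fin ni → Bool) → S × (Fin no → Bool)

module _ {ni no : ℕ} where

  -- the letter ι ∪ o ∈ 2^AP
  merge : (Fin ni → Bool) → (Fin no → Bool) → AP ni no → Bool
  merge ι o (inj₁ x) = ι x
  merge ι o (inj₂ y) = o y

  IsTrace : TS ni no → Word {AP ni no} → Set
  IsTrace T w =
    Σ (ℕ → (Fin ni → Bool)) λ ι →
    Σ (ℕ → (Fin no → Bool)) λ o →
    Σ (ℕ → TS.S T) λ s →
      (s 0 ≡ TS.s₀ T)
      × (∀ i → TS.τ T (s i) (ι i) ≡ (s (suc i) , o i))
      × (∀ i p → w i p ≡ merge (ι i) (o i) p)

  _⊨_ : TS ni no → LTL (AP ni no) → Set
  T ⊨ ψ = ∀ w → IsTrace T w → Sat w 0 ψ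

b2n : Bool → ℕ
b2n true = 1
b2n false = 0

sumFin : (n : ℕ) → (Fin n → ℕ) → ℕ
sumFin zero f = 0
sumFin (suc n) f = f zero + sumFin n (λ i → f (suc i))

Triple : Set
Triple = ℕ × ℕ × ℕ

module _ {ni no : ℕ} where

  -- ValG T φ (v₁ , v₂ , v₃) : val_T(G φ) = (v₁,v₂,v₃) (as bits)
  ValG : TS ni no → LTL (AP ni no) → Bool × Bool × Bool → Set
  ValG T φ (v₁ , v₂ , v₃) =
    Reflects (T ⊨ Gₗ φ) v₁ × Reflects (T ⊨ Fₗ (Gₗ φ)) v₂ × Reflects (T ⊨ Gₗ (Fₗ φ)) v₃

  Val : TS ni no → (n : ℕ) → (Fin n → LTL (AP ni no)) → Triple → Set
  Val T n φ v =
    Σ (Fin n → Bool × Bool × Bool) λ b →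
      (∀ i → ValG T (φ i) (b i))
      × v ≡ ( sumFin n (λ i → b2n (Data.Product.proj₂ (Data.Product.proj₂ (b i))))
            , sumFin n (λ i → b2n (Data.Product.proj₁ (Data.Product.proj₂ (b i))))
            , sumFin n (λ i → b2n (Data.Product.proj₁ (b i))) )

_≥lex_ : Triple → Triple → Set
(a₁ , a₂ , a₃) ≥lex (b₁ , b₂ , b₃) =
  a₁ > b₁ ⊎ (a₁ ≡ b₁ × (a₂ > b₂ ⊎ (a₂ ≡ b₂ × b₃ ≤ a₃)))

data Choice : Set where
  cG cFG cGF cTrue : Choice

module _ {A : Set} where
  applyChoice : Choice → LTL A → LTL A
  applyChoice cG φ = Gₗ φ
  applyChoice cFG φ = Fₗ (Gₗ φ)
  applyChoice cGF φ = Gₗ (Fₗ φ)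
  applyChoice cTrue φ = tt

module Submission where

-- The three properties measured by val are ordered by strength:
-- every word satisfying G φ satisfies F G φ, and every word satisfying F G φ
-- satisfies G F φ.  Hence the bit triple val_T(G φᵢ) is determined by the
-- STRONGEST of the three properties that T satisfies, and we take that one
-- (or true, if none holds) as the conjunct φᵢ'.  Then T ⊨ ψ by construction,
-- and any T′ ⊨ ψ satisfies, for every i, the chosen property of φᵢ and hence
-- every weaker one; so each bit of val_{T′}(G φᵢ) dominates the
-- corresponding bit of val_T(G φᵢ).  Summing gives componentwise domination
-- of the value triples, which implies lexicographic domination.

open import Defs
open import Data.Nat using (ℕ; zero; suc; _+_; _≤_; z≤n)
open import Data.Nat.Properties using (+-comm; +-assoc; +-mono-≤; ≤-refl; m≤n⇒m<n∨m≡n)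
open import Data.Fin using (Fin; zero; suc)
open import Data.Product using (Σ; _×_; _,_; proj₁; proj₂)
open import Data.Sum using (inj₁; inj₂)
open import Data.Bool using (Bool; true; false)
open import Data.Unit using (tt)
open import Data.Empty using (⊥-elim)
open import Relation.Nullary.Reflects using (Reflects; ofʸ; ofⁿ)
open import Relation.Binary.PropositionalEquality using (_≡_; refl; sym; cong; subst; module ≡-Reasoning)

module _ {A : Set} where

  G-at : ∀ {w : Word {A}} {i φ} → Sat w i (Gₗ φ) → ∀ j → Sat w (j + i) φ
  G-at g j with g j
  ... | inj₁ φ-holds   = φ-holds
  ... | inj₂ (_ , _ , ())

  G⇒FG-word : ∀ {w : Word {A}} {i φ} → Sat w i (Gₗ φ) → Sat w i (Fₗ (Gₗ φ))
  G⇒FG-word g = 0 , g , λ _ ()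

  -- F G φ ⇒ G F φ: if φ holds forever from position j₀ + i, then from any
  -- position j + i the position j₀ + (j + i) is a future witness of φ.
  FG⇒GF-word : ∀ {w : Word {A}} {i φ} → Sat w i (Fₗ (Gₗ φ)) → Sat w i (Gₗ (Fₗ φ))
  FG⇒GF-word {w} {i} {φ} (j₀ , g , _) j =
    inj₁ (j₀ , subst (λ k → Sat w k φ) (shift j) (G-at {w = w} {i = j₀ + i} {φ = φ} g j) , λ _ _ → tt)
    where
    shift : ∀ j → j + (j₀ + i) ≡ j₀ + (j + i)
    shift j = begin
      j + (j₀ + i)  ≡⟨ sym (+-assoc j j₀ i) ⟩
      (j + j₀) + i  ≡⟨ cong (_+ i) (+-comm j j₀) ⟩
      (j₀ + j) + i  ≡⟨ +-assoc j₀ j i ⟩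
      j₀ + (j + i)  ∎
      where open ≡-Reasoning

  ⋀-intro-word : ∀ {w : Word {A}} {i} n (χ : Fin n → LTL A) →
                 (∀ k → Sat w i (χ k)) → Sat w i (⋀ n χ)
  ⋀-intro-word zero    χ h = tt
  ⋀-intro-word (suc n) χ h = h zero , ⋀-intro-word n (λ k → χ (suc k)) (λ k → h (suc k))

  ⋀-elim-word : ∀ {w : Word {A}} {i} n (χ : Fin n → LTL A) →
                Sat w i (⋀ n χ) → ∀ k → Sat w i (χ k)
  ⋀-elim-word (suc n) χ (h , _) zero    = h
  ⋀-elim-word (suc n) χ (_ , h) (suc k) = ⋀-elim-word n (λ k → χ (suc k)) h k

-- Lemmas about validity in a fixed transition system T (passed explicitly,
-- since T ⊨ φ unfolds to a statement from which T cannot be inferred).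
module _ {ni no : ℕ} (T : TS ni no) where

  ⊨-mono : ∀ φ ψ →
           (∀ (w : Word) → Sat w 0 φ → Sat w 0 ψ) → T ⊨ φ → T ⊨ ψ
  ⊨-mono φ ψ imp h w trace = imp w (h w trace)

  G⇒FG : ∀ φ → T ⊨ Gₗ φ → T ⊨ Fₗ (Gₗ φ)
  G⇒FG φ = ⊨-mono (Gₗ φ) (Fₗ (Gₗ φ)) λ w → G⇒FG-word {w = w} {φ = φ}

  FG⇒GF : ∀ φ → T ⊨ Fₗ (Gₗ φ) → T ⊨ Gₗ (Fₗ φ)
  FG⇒GF φ = ⊨-mono (Fₗ (Gₗ φ)) (Gₗ (Fₗ φ)) λ w → FG⇒GF-word {w = w} {φ = φ}

  ⋀-intro : ∀ n (χ : Fin n → LTL (AP ni no)) →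
            (∀ k → T ⊨ χ k) → T ⊨ ⋀ n χ
  ⋀-intro n χ h w trace = ⋀-intro-word {w = w} n χ (λ k → h k w trace)

  ⋀-elim : ∀ n (χ : Fin n → LTL (AP ni no)) →
           T ⊨ ⋀ n χ → ∀ k → T ⊨ χ k
  ⋀-elim n χ h k w trace = ⋀-elim-word {w = w} n χ (h w trace) k

strongest : Bool × Bool × Bool → Choice
strongest (true  , _     , _    ) = cG
strongest (false , true  , _    ) = cFG
strongest (false , false , true ) = cGF
strongest (false , false , false) = cTrue

module _ {ni no : ℕ} (T : TS ni no) where

  Guarantees : LTL (AP ni no) → Bool × Bool × Bool → Set
  Guarantees φ (b₁ , b₂ , b₃) =
    (b₁ ≡ true → T ⊨ Gₗ φ) × (b₂ ≡ true → T ⊨ Fₗ (Gₗ φ)) × (b₃ ≡ true → T ⊨ Gₗ (Fₗ φ))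

  strongest-holds : ∀ φ b → ValG T φ b → T ⊨ applyChoice (strongest b) φ
  strongest-holds φ (true  , _     , _    ) (ofʸ p , _)     = p
  strongest-holds φ (false , true  , _    ) (_ , ofʸ p , _) = p
  strongest-holds φ (false , false , true ) (_ , _ , ofʸ p) = p
  strongest-holds φ (false , false , false) _               = λ _ _ → tt

  strongest-guarantees : ∀ φ b →
                         T ⊨ applyChoice (strongest b) φ → Guarantees φ b
  strongest-guarantees φ (true  , _     , _    ) h =
    (λ _ → h) , (λ _ → G⇒FG T φ h) , (λ _ → FG⇒GF T φ (G⇒FG T φ h))
  strongest-guarantees φ (false , true  , _    ) h = (λ ()) , (λ _ → h) , (λ _ → FG⇒GF T φ h)
  strongest-guarantees φ (false , false , true ) h = (λ ()) , (λ ()) , (λ _ → h)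
  strongest-guarantees φ (false , false , false) h = (λ ()) , (λ ()) , (λ ())

b2n-mono : ∀ {P : Set} {x : Bool} (y : Bool) → Reflects P x → (y ≡ true → P) → b2n y ≤ b2n x
b2n-mono false _        _     = z≤n
b2n-mono true  (ofʸ _)  _     = ≤-refl
b2n-mono true  (ofⁿ ¬p) force = ⊥-elim (¬p (force refl))

sumFin-mono : ∀ n {f g : Fin n → ℕ} → (∀ i → f i ≤ g i) → sumFin n f ≤ sumFin n g
sumFin-mono zero    h = z≤n
sumFin-mono (suc n) h = +-mono-≤ (h zero) (sumFin-mono n (λ i → h (suc i)))

≤³⇒≥lex : ∀ {a₁ a₂ a₃ b₁ b₂ b₃} → b₁ ≤ a₁ → b₂ ≤ a₂ → b₃ ≤ a₃ →
          (a₁ , a₂ , a₃) ≥lex (b₁ , b₂ , b₃)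
≤³⇒≥lex b₁≤a₁ b₂≤a₂ b₃≤a₃ with m≤n⇒m<n∨m≡n b₁≤a₁
... | inj₁ b₁<a₁ = inj₁ b₁<a₁
... | inj₂ refl with m≤n⇒m<n∨m≡n b₂≤a₂
...   | inj₁ b₂<a₂ = inj₂ (refl , inj₁ b₂<a₂)
...   | inj₂ refl  = inj₂ (refl , inj₂ (refl , b₃≤a₃))

valueOf : (n : ℕ) → (Fin n → Bool × Bool × Bool) → Triple
valueOf n b = ( sumFin n (λ i → b2n (proj₂ (proj₂ (b i))))
              , sumFin n (λ i → b2n (proj₁ (proj₂ (b i))))
              , sumFin n (λ i → b2n (proj₁ (b i))) )

module _ {ni no : ℕ} (T′ : TS ni no) where

  guarantees⇒≥lex : ∀ n (φ : Fin n → LTL (AP ni no)) b b′ →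
                    (∀ i → ValG T′ (φ i) (b′ i)) → (∀ i → Guarantees T′ (φ i) (b i)) →
                    valueOf n b′ ≥lex valueOf n b
  guarantees⇒≥lex n φ b b′ val guar = ≤³⇒≥lex
    (sumFin-mono n λ i → b2n-mono (proj₂ (proj₂ (b i))) (proj₂ (proj₂ (val i))) (proj₂ (proj₂ (guar i))))
    (sumFin-mono n λ i → b2n-mono (proj₁ (proj₂ (b i))) (proj₁ (proj₂ (val i))) (proj₁ (proj₂ (guar i))))
    (sumFin-mono n λ i → b2n-mono (proj₁ (b i)) (proj₁ (val i)) (proj₁ (guar i)))

lemma2 : {ni no : ℕ} (T : TS ni no) (n : ℕ) (φ : Fin n → LTL (AP ni no))
    → (∀ i → SyntacticallySafe (φ i))
    → (v : Triple) → Val T n φ v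
    → Σ (Fin n → Choice) λ c →
    let ψ = ⋀ n (λ i → applyChoice (c i) (φ i)) in
    (T ⊨ ψ)
    × (∀ (T′ : TS ni no) → T′ ⊨ ψ → ∀ v′ → Val T′ n φ v′ → v′ ≥lex v)
lemma2 T n φ _ _ (b , val , refl) = choice , holds , dominates
  where
  choice : Fin n → Choice
  choice i = strongest (b i)

  conjuncts : Fin n → LTL (AP _ _)
  conjuncts i = applyChoice (choice i) (φ i)

  holds : T ⊨ ⋀ n conjuncts
  holds = ⋀-intro T n conjuncts (λ i → strongest-holds T (φ i) (b i) (val i))

  dominates : ∀ T′ → T′ ⊨ ⋀ n conjuncts → ∀ v′ → Val T′ n φ v′ → v′ ≥lex valueOf n b
  dominates T′ h _ (b′ , val′ , refl) =
    guarantees⇒≥lex T′ n φ b b′ val′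
      (λ i → strongest-guarantees T′ (φ i) (b i) (⋀-elim T′ n conjuncts h i))
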